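{- Let $\epsilon$ be a positive integer. Let $\beta:\mathbb{Q}_+^5\to\mathbb{Q}_+^5$ be the bijection $\beta(a,b,c,d,e)=(b,c,\frac{ac+be}{d},a,e)$, and let $\varphi:\mathbb{Q}_+^5\to\mathbb{Q}_+^3$ be $$\varphi(a,b,c,d,e)=\Big(\frac{a^2+b^2+cd}{ab},\ \frac{c^2d+a^2c+b^2d+abe}{bcd},\ \frac{cd^2+a^2c+b^2d+abe}{acd}\Big).$$ Let $$S(3,4,4)=\varphi^{ -1}(3,4,4)\cap\{P=(a,b,c,d,\epsilon)\in\mathbb{N}^5\mid P\equiv 0\pmod{\epsilon}\}.$$ Then $S(3,4,4)$ is the orbit of $(\epsilon,\epsilon,\epsilon,\epsilon,\epsilon)$ under the cyclic group $\langle\beta^3\rangle$: $$S(3,4,4)=\{\beta^{3n}(\epsilon,\epsilon,\epsilon,\epsilon,\epsilon)\mid n\in\mathbb{Z}\}.$$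
   Context: $\mathbb{N}$ denotes the positive integers and $\mathbb{Q}_+$ the positive rationals. For a vector $P$, $P\equiv 0\pmod{\epsilon}$ means every component of $P$ is divisible by $\epsilon$. -}

module Defs where

open import Data.Nat as ℕ using (ℕ; zero; suc)
open import Data.Integer as ℤ using (ℤ; +_; -[1+_])
import Data.Nat.Coprimality as C
open import Data.Rational using (ℚ; mkℚ; _+_; _*_; _÷_; _/_; 1/_; Positive)
open import Data.Rational.Properties using (pos+pos⇒pos; pos*pos⇒pos; pos⇒nonZero; 1/pos⇒pos)
open import Data.Product using (_×_; _,_)
open import Function using (_∘_)

record ℚ⁺ : Set where
  constructor ⟨_⟩
  field
    val : ℚ
    .{{pos}} : Positive val
open ℚ⁺ public

infixl 6 _+⁺_
infixl 7 _*⁺_ _÷⁺_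

_+⁺_ : ℚ⁺ → ℚ⁺ → ℚ⁺
record { val = x ; pos = px } +⁺ record { val = y ; pos = py } =
  record { val = x + y ; pos = pos+pos⇒pos x {{px}} y {{py}} }

_*⁺_ : ℚ⁺ → ℚ⁺ → ℚ⁺
record { val = x ; pos = px } *⁺ record { val = y ; pos = py } =
  record { val = x * y ; pos = pos*pos⇒pos x {{px}} y {{py}} }

_÷⁺_ : ℚ⁺ → ℚ⁺ → ℚ⁺
record { val = x ; pos = px } ÷⁺ record { val = y ; pos = py } = record
  { val = (x ÷ y) {{pos⇒nonZero y {{py}}}}
  ; pos = pos*pos⇒pos x {{px}} ((1/ y) {{pos⇒nonZero y {{py}}}}) {{1/pos⇒pos y {{py}}}} }

ℕ→ℚ : ℕ → ℚ
ℕ→ℚ n = mkℚ (+ n) 0 (C.sym (C.1-coprimeTo n))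

ℕ→ℚ⁺ : (n : ℕ) → .{{ℕ.NonZero n}} → ℚ⁺
ℕ→ℚ⁺ (suc k) = record { val = ℕ→ℚ (suc k) ; pos = _ }

Q5⁺ : Set
Q5⁺ = ℚ⁺ × ℚ⁺ × ℚ⁺ × ℚ⁺ × ℚ⁺

vals : Q5⁺ → ℚ × ℚ × ℚ × ℚ × ℚ
vals (a , b , c , d , e) = val a , val b , val c , val d , val e

β : Q5⁺ → Q5⁺
β (a , b , c , d , e) = b , c , (a *⁺ c +⁺ b *⁺ e) ÷⁺ d , a , e

β⁻¹ : Q5⁺ → Q5⁺
β⁻¹ (a , b , c , d , e) = d , a , b , (d *⁺ b +⁺ a *⁺ e) ÷⁺ c , e

iterate : {A : Set} → (A → A) → ℕ → A → A
iterate f zero x = x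
iterate f (suc n) x = f (iterate f n x)

β³^ : ℤ → Q5⁺ → Q5⁺
β³^ (+ n) = iterate β (3 ℕ.* n)
β³^ -[1+ n ] = iterate β⁻¹ (3 ℕ.* suc n)

φ : Q5⁺ → ℚ⁺ × ℚ⁺ × ℚ⁺
φ (a , b , c , d , e) =
  (a *⁺ a +⁺ b *⁺ b +⁺ c *⁺ d) ÷⁺ (a *⁺ b) ,
  (c *⁺ c *⁺ d +⁺ a *⁺ a *⁺ c +⁺ b *⁺ b *⁺ d +⁺ a *⁺ b *⁺ e) ÷⁺ (b *⁺ c *⁺ d) ,
  (c *⁺ d *⁺ d +⁺ a *⁺ a *⁺ c +⁺ b *⁺ b *⁺ d +⁺ a *⁺ b *⁺ e) ÷⁺ (a *⁺ c *⁺ d)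

φvals : Q5⁺ → ℚ × ℚ × ℚ
φvals P with φ P
... | x , y , z = val x , val y , val z

open import Data.Nat.Divisibility using (_∣_)
open import Data.Product using (∃-syntax)
open import Relation.Binary.PropositionalEquality using (_≡_)

InS : (ε : ℕ) → Q5⁺ → Set
InS ε P = ∃[ a ] ∃[ b ] ∃[ c ] ∃[ d ]
  ( vals P ≡ (ℕ→ℚ a , ℕ→ℚ b , ℕ→ℚ c , ℕ→ℚ d , ℕ→ℚ ε)
  × (ε ∣ a × ε ∣ b × ε ∣ c × ε ∣ d × ε ∣ ε)
  × φvals P ≡ (ℕ→ℚ 3 , ℕ→ℚ 4 , ℕ→ℚ 4) )

diag : (ε : ℕ) → .{{ℕ.NonZero ε}} → Q5⁺
diag ε = ℕ→ℚ⁺ ε , ℕ→ℚ⁺ ε , ℕ→ℚ⁺ ε , ℕ→ℚ⁺ ε , ℕ→ℚ⁺ ε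

InOrbit : (ε : ℕ) → .{{ℕ.NonZero ε}} → Q5⁺ → Set
InOrbit ε P = ∃[ n ] vals (β³^ n (diag ε)) ≡ vals P

module Submission where

-- Write P = ε·(a, b, c, d, 1). Clearing denominators, φ(P) = (3, 4, 4) says exactly that
-- d = δ(a, b, c) = 4a − 4b + c and that (a, b, c) lies on the cone Q = 0, ℓ = 1 (Q and ℓ
-- below).  In these coordinates β³ becomes μ = σ ∘ τ, a product of two linear involutions
-- preserving Q and ℓ, and each of the three β-steps is an instance of the exchange relation
-- D·F = A·C + B·E, which also keeps all coordinates positive.  Conversely, every positive
-- triple on the cone descends to (1, 1, 1): with T = a − b and U the change of a + b under τ,
-- 63Q + 9ℓ² = 99T² + 33TU + U², so on the cone U < 0 as soon as T > 0.  Hence τ, or τ after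
-- the swap σ, strictly decreases a + b until a = b, where Q = (c − a)(c + a) and ℓ = a force
-- a = b = c = 1.

open import Data.Empty using (⊥-elim)
import Data.Empty.Irrelevant as Irrelevant
open import Data.Integer as ℤ using (ℤ; +_; -[1+_]; 0ℤ; 1ℤ; _+_; _*_; _-_; -_; _<_; _≤_; ∣_∣; +<+; +≤+)
import Data.Integer.Properties as ℤₚ
open import Data.Integer.Properties using (<-cmp)
open import Data.Integer.Tactic.RingSolver using (solve-∀; solve)
open import Data.List using ([]; _∷_)
open import Data.Nat as ℕ using (ℕ; NonZero; zero; suc; z≤n; z<s)
import Data.Nat.Coprimality as Coprime
open import Data.Nat.Divisibility using (divides-refl; ∣-refl)
open import Data.Nat.Induction using (<-wellFounded)
import Data.Nat.Properties as ℕₚ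
open import Data.Product using (_×_; _,_; proj₁; proj₂; ∃-syntax)
open import Data.Product.Function.NonDependent.Propositional using (_×-⇔_)
open import Data.Rational as ℚ using (ℚ; mkℚ; _÷_)
import Data.Rational.Properties as ℚₚ
import Data.Rational.Unnormalised as ℚᵘ
import Data.Rational.Unnormalised.Properties as ℚᵘₚ
open import Data.Sum using (inj₁; inj₂)
open import Function using (_∘_)
open import Function.Bundles using (_⇔_; mk⇔; Equivalence)
open import Function.Construct.Composition using (_⇔-∘_)
open import Induction.WellFounded using (Acc; acc)
open import Relation.Binary.Definitions using (tri<; tri≈; tri>)
open import Relation.Binary.PropositionalEquality

open import Defs

-- The cone and the two involutions

Triple : Set
Triple = ℤ × ℤ × ℤ

-- INLINE lets the reflective ring solver see through these polynomials.
Q : ℤ → ℤ → ℤ → ℤ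
Q a b c = a * a + b * b + c * c + + 4 * (a * c) - + 4 * (b * c) - + 3 * (a * b)
{-# INLINE Q #-}

ℓ : ℤ → ℤ → ℤ → ℤ
ℓ a b c = - (+ 4 * a) + + 8 * b - + 3 * c
{-# INLINE ℓ #-}

δ : ℤ → ℤ → ℤ → ℤ
δ a b c = + 4 * a - + 4 * b + c
{-# INLINE δ #-}

τ₁ τ₂ : ℤ → ℤ → ℤ → ℤ
τ₁ a b c = + 3 * a - + 8 * b + + 8 * c
τ₂ a b c = a - + 3 * b + + 4 * c
{-# INLINE τ₁ #-}
{-# INLINE τ₂ #-}

σ τ μ μ⁻¹ : Triple → Triple
σ (a , b , c) = b , a , δ a b c
τ (a , b , c) = τ₁ a b c , τ₂ a b c , c
μ s = σ (τ s)
μ⁻¹ s = τ (σ s)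

δ-σ : ∀ a b c → δ b a (δ a b c) ≡ c
δ-σ = solve-∀

σ-involutive : ∀ s → σ (σ s) ≡ s
σ-involutive (a , b , c) = cong (λ z → a , b , z) (δ-σ a b c)

τ-involutive : ∀ s → τ (τ s) ≡ s
τ-involutive (a , b , c) = cong₂ (λ x y → x , y , c) (τ₁-τ a b c) (τ₂-τ a b c)
  where
  τ₁-τ : ∀ a b c → τ₁ (τ₁ a b c) (τ₂ a b c) c ≡ a
  τ₁-τ = solve-∀
  τ₂-τ : ∀ a b c → τ₂ (τ₁ a b c) (τ₂ a b c) c ≡ b
  τ₂-τ = solve-∀

μ-μ⁻¹ : ∀ s → μ (μ⁻¹ s) ≡ s
μ-μ⁻¹ s = trans (cong σ (τ-involutive (σ s))) (σ-involutive s)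

μ⁻¹-μ : ∀ s → μ⁻¹ (μ s) ≡ s
μ⁻¹-μ s = trans (cong τ (σ-involutive (τ s))) (τ-involutive s)

Q-σ : ∀ a b c → Q b a (δ a b c) ≡ Q a b c
Q-σ = solve-∀

ℓ-σ : ∀ a b c → ℓ b a (δ a b c) ≡ ℓ a b c
ℓ-σ = solve-∀

Q-τ : ∀ a b c → Q (τ₁ a b c) (τ₂ a b c) c ≡ Q a b c
Q-τ = solve-∀

ℓ-τ : ∀ a b c → ℓ (τ₁ a b c) (τ₂ a b c) c ≡ ℓ a b c
ℓ-τ = solve-∀

record OnCone (a b c : ℤ) : Set where
  field
    Q≡0 : Q a b c ≡ 0ℤ
    ℓ≡1 : ℓ a b c ≡ 1ℤ
    a>0 : 0ℤ < a
    b>0 : 0ℤ < b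
    c>0 : 0ℤ < c
    δ>0 : 0ℤ < δ a b c

InCone : Triple → Set
InCone (a , b , c) = OnCone a b c

≡-mod-cone : ∀ {a b c x y} → OnCone a b c → ∀ u v →
             x ≡ y + u * Q a b c + v * (ℓ a b c - 1ℤ) → x ≡ y
≡-mod-cone {y = y} cone u v x≡ = trans x≡ (trans
  (cong₂ (λ q l → y + u * q + v * (l - 1ℤ)) (OnCone.Q≡0 cone) (OnCone.ℓ≡1 cone))
  (vanish y u v))
  where
  vanish : ∀ y u v → y + u * 0ℤ + v * (1ℤ - 1ℤ) ≡ y
  vanish = solve-∀

>0-* : ∀ {i j} → 0ℤ < i → 0ℤ < j → 0ℤ < i * j
>0-* (+<+ z<s) (+<+ z<s) = +<+ z<s

>0-cofactor : ∀ {i j} → 0ℤ < i → 0ℤ < i * j → 0ℤ < j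
>0-cofactor {i} i>0 ij>0 =
  ℤₚ.*-cancelˡ-<-nonNeg i {{ℤ.nonNegative (ℤₚ.<⇒≤ i>0)}} (subst (_< i * _) (sym (ℤₚ.*-zeroʳ i)) ij>0)

>0-exchange : ∀ {a b c d f} → 0ℤ < d → d * f ≡ a * c + b → 0ℤ < a → 0ℤ < c → 0ℤ < b → 0ℤ < f
>0-exchange d>0 df≡ a>0 c>0 b>0 =
  >0-cofactor d>0 (subst (0ℤ <_) (sym df≡) (ℤₚ.+-mono-< (>0-* a>0 c>0) b>0))

module _ {a b c} (cone : OnCone a b c) where
  open OnCone cone

  -- The exchange relation D·F = A·C + B·E of β along the three steps of β³ from (a, b, c, δ, 1).
  exchange₁ : δ a b c * τ₂ a b c ≡ a * c + b
  exchange₁ = ≡-mod-cone cone (+ 4) b (solve (a ∷ b ∷ c ∷ []))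

  exchange₂ : a * τ₁ a b c ≡ b * τ₂ a b c + c
  exchange₂ = ≡-mod-cone cone (+ 3) c (solve (a ∷ b ∷ c ∷ []))

  exchange₃ : b * δ (τ₁ a b c) (τ₂ a b c) c ≡ c * τ₁ a b c + τ₂ a b c
  exchange₃ = ≡-mod-cone cone (+ 4) (τ₂ a b c) (solve (a ∷ b ∷ c ∷ []))

  σ-onCone : OnCone b a (δ a b c)
  σ-onCone = record
    { Q≡0 = trans (Q-σ a b c) Q≡0 ; ℓ≡1 = trans (ℓ-σ a b c) ℓ≡1
    ; a>0 = b>0 ; b>0 = a>0 ; c>0 = δ>0 ; δ>0 = subst (0ℤ <_) (sym (δ-σ a b c)) c>0 }

  τ-onCone : OnCone (τ₁ a b c) (τ₂ a b c) c
  τ-onCone = record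
    { Q≡0 = trans (Q-τ a b c) Q≡0 ; ℓ≡1 = trans (ℓ-τ a b c) ℓ≡1
    ; a>0 = τ₁>0 ; b>0 = τ₂>0 ; c>0 = c>0
    ; δ>0 = >0-exchange b>0 exchange₃ c>0 τ₁>0 τ₂>0 }
    where
    τ₂>0 : 0ℤ < τ₂ a b c
    τ₂>0 = >0-exchange δ>0 exchange₁ a>0 c>0 b>0
    τ₁>0 : 0ℤ < τ₁ a b c
    τ₁>0 = >0-exchange a>0 exchange₂ b>0 τ₂>0 c>0

σ-inCone : ∀ s → InCone s → InCone (σ s)
σ-inCone (a , b , c) = σ-onCone

τ-inCone : ∀ s → InCone s → InCone (τ s)
τ-inCone (a , b , c) = τ-onCone

μ-inCone : ∀ s → InCone s → InCone (μ s)
μ-inCone s = σ-inCone (τ s) ∘ τ-inCone s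

μ⁻¹-inCone : ∀ s → InCone s → InCone (μ⁻¹ s)
μ⁻¹-inCone s = τ-inCone (σ s) ∘ σ-inCone s

-- Descent to (1, 1, 1)

base : Triple
base = 1ℤ , 1ℤ , 1ℤ

μ^ : ℤ → Triple → Triple
μ^ (+ n)     = iterate μ n
μ^ -[1+ n ] = iterate μ⁻¹ (suc n)

μ-μ^ : ∀ k s → μ (μ^ k s) ≡ μ^ (ℤ.suc k) s
μ-μ^ (+ n)          s = refl
μ-μ^ -[1+ zero ]   s = μ-μ⁻¹ s
μ-μ^ -[1+ suc n ]  s = μ-μ⁻¹ (iterate μ⁻¹ (suc n) s)

μ⁻¹-μ^ : ∀ k s → μ⁻¹ (μ^ k s) ≡ μ^ (ℤ.pred k) s
μ⁻¹-μ^ (+ zero)   s = refl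
μ⁻¹-μ^ (+ suc n)  s = μ⁻¹-μ (iterate μ n s)
μ⁻¹-μ^ -[1+ n ]  s = refl

size : Triple → ℕ
size (a , b , _) = ∣ a + b ∣

size-σ : ∀ s → size (σ s) ≡ size s
size-σ (a , b , _) = cong ∣_∣ (ℤₚ.+-comm b a)

conic-identity : ∀ a b c → + 63 * Q a b c + + 9 * (ℓ a b c * ℓ a b c) ≡
                 + 99 * ((a - b) * (a - b)) + + 33 * ((a - b) * (τ₁ a b c + τ₂ a b c - (a + b)))
                 + (τ₁ a b c + τ₂ a b c - (a + b)) * (τ₁ a b c + τ₂ a b c - (a + b))
conic-identity = solve-∀

0≤-* : ∀ {i j} → 0ℤ ≤ i → 0ℤ ≤ j → 0ℤ ≤ i * j
0≤-* {+ m} {+ n} _ _ = subst (0ℤ ≤_) (ℤₚ.pos-* m n) (+≤+ z≤n)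

≤-+-nonNeg : ∀ {i j} → 0ℤ ≤ j → i ≤ i + j
≤-+-nonNeg {i} {j} j≥0 = ℤₚ.i≤i+j i j {{ℤ.nonNegative j≥0}}

conic>9 : ∀ {T U} → 0ℤ < T → 0ℤ ≤ U → + 9 < + 99 * (T * T) + + 33 * (T * U) + U * U
conic>9 {T} {U} T>0@(+<+ {n = suc t} _) U≥0 = begin-strict
  + 9                                      <⟨ +<+ (ℕₚ.<-≤-trans (ℕₚ.m<m+n 9 z<s) (ℕₚ.m≤m*n 99 (suc t ℕ.* suc t))) ⟩
  + 99 * (T * T)                           ≤⟨ ≤-+-nonNeg (0≤-* {+ 33} (+≤+ z≤n) (0≤-* (ℤₚ.<⇒≤ T>0) U≥0)) ⟩
  + 99 * (T * T) + + 33 * (T * U)          ≤⟨ ≤-+-nonNeg (0≤-* U≥0 U≥0) ⟩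
  + 99 * (T * T) + + 33 * (T * U) + U * U  ∎
  where open ℤₚ.≤-Reasoning

∣∣-mono-< : ∀ {i j} → 0ℤ ≤ i → i < j → ∣ i ∣ ℕ.< ∣ j ∣
∣∣-mono-< (+≤+ _) (+<+ m<n) = m<n

<⇒0<- : ∀ {i j} → i < j → 0ℤ < j - i
<⇒0<- {i} {j} i<j = subst (_< j - i) (ℤₚ.+-inverseʳ i) (ℤₚ.+-monoˡ-< (- i) i<j)

τ-shrinks : ∀ {a b c} → OnCone a b c → b < a → size (τ (a , b , c)) ℕ.< size (a , b , c)
τ-shrinks {a} {b} {c} cone b<a = ∣∣-mono-< (ℤₚ.<⇒≤ (ℤₚ.+-mono-< τ₁>0 τ₂>0)) τ-sum<
  where
  open OnCone (τ-onCone cone) renaming (a>0 to τ₁>0; b>0 to τ₂>0)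
  conic≡9 : + 9 ≡ + 99 * ((a - b) * (a - b)) + + 33 * ((a - b) * (τ₁ a b c + τ₂ a b c - (a + b)))
                  + (τ₁ a b c + τ₂ a b c - (a + b)) * (τ₁ a b c + τ₂ a b c - (a + b))
  conic≡9 = trans (cong₂ (λ q l → + 63 * q + + 9 * (l * l)) (sym (OnCone.Q≡0 cone)) (sym (OnCone.ℓ≡1 cone)))
                  (conic-identity a b c)
  τ-sum< : τ₁ a b c + τ₂ a b c < a + b
  τ-sum< = ℤₚ.≰⇒> λ a+b≤τ-sum →
    ℤₚ.<-irrefl conic≡9 (conic>9 (<⇒0<- b<a) (ℤₚ.i≤j⇒0≤j-i a+b≤τ-sum))

diagonal : ∀ {a c} → OnCone a a c → (a , a , c) ≡ base
diagonal {a} {c} cone = cong₂ (λ x y → x , x , y) a≡1 (trans c≡a a≡1)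
  where
  open OnCone cone
  Q-diagonal : ∀ a c → Q a a c ≡ (c - a) * (c + a)
  Q-diagonal = solve-∀
  ℓ-diagonal : ∀ a → ℓ a a a ≡ a
  ℓ-diagonal = solve-∀
  c≡a : c ≡ a
  c≡a with ℤₚ.i*j≡0⇒i≡0∨j≡0 (c - a) (trans (sym (Q-diagonal a c)) Q≡0)
  ... | inj₁ c-a≡0 = ℤₚ.i-j≡0⇒i≡j c a c-a≡0
  ... | inj₂ c+a≡0 = ⊥-elim (ℤₚ.<-irrefl (sym c+a≡0) (ℤₚ.+-mono-< c>0 a>0))
  a≡1 : a ≡ 1ℤ
  a≡1 = trans (sym (ℓ-diagonal a)) (subst (λ z → ℓ a a z ≡ 1ℤ) c≡a ℓ≡1)

inCone⇒orbit : ∀ s → InCone s → ∃[ k ] μ^ k base ≡ s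
inCone⇒orbit s = descend s (<-wellFounded (size s))
  where
  descend : ∀ s → Acc ℕ._<_ (size s) → InCone s → ∃[ k ] μ^ k base ≡ s
  descend s@(a , b , c) (acc smaller) cone with <-cmp a b
  ... | tri≈ _ refl _ = 0ℤ , sym (diagonal cone)
  ... | tri> _ _ b<a =
    let k , μ^k≡μs = descend (μ s) (smaller (subst (ℕ._< size s) (sym (size-σ (τ s))) (τ-shrinks cone b<a)))
                                  (μ-inCone s cone)
    in ℤ.pred k , trans (sym (μ⁻¹-μ^ k base)) (trans (cong μ⁻¹ μ^k≡μs) (μ⁻¹-μ s))
  ... | tri< a<b _ _ =
    let k , μ^k≡μ⁻¹s = descend (μ⁻¹ s) (smaller (subst (size (μ⁻¹ s) ℕ.<_) (size-σ s) (τ-shrinks (σ-onCone cone) a<b)))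
                                    (μ⁻¹-inCone s cone)
    in ℤ.suc k , trans (sym (μ-μ^ k base)) (trans (cong μ μ^k≡μ⁻¹s) (μ-μ⁻¹ s))

-- Clearing the denominators of φ

Φ₁ : ℤ → ℤ → ℤ → ℤ → ℤ
Φ₁ A B C D = A * A + B * B + C * D - + 3 * (A * B)
{-# INLINE Φ₁ #-}

Φ₂ Φ₃ : ℤ → ℤ → ℤ → ℤ → ℤ → ℤ
Φ₂ A B C D E = C * C * D + A * A * C + B * B * D + A * B * E - + 4 * (B * C * D)
Φ₃ A B C D E = C * D * D + A * A * C + B * B * D + A * B * E - + 4 * (A * C * D)
{-# INLINE Φ₂ #-}
{-# INLINE Φ₃ #-}

Φ-vanish : ℤ → ℤ → ℤ → ℤ → ℤ → Set
Φ-vanish A B C D E = Φ₁ A B C D ≡ 0ℤ × Φ₂ A B C D E ≡ 0ℤ × Φ₃ A B C D E ≡ 0ℤ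

>0⇒≢0 : ∀ {i} → 0ℤ < i → i ≢ 0ℤ
>0⇒≢0 i>0 i≡0 = ℤₚ.<-irrefl (sym i≡0) i>0

*≡0⇔≡0 : ∀ {k i} → 0ℤ < k → (k * i ≡ 0ℤ) ⇔ (i ≡ 0ℤ)
*≡0⇔≡0 {k} {i} k>0 = mk⇔ to (λ i≡0 → trans (cong (k *_) i≡0) (ℤₚ.*-zeroʳ k))
  where
  to : k * i ≡ 0ℤ → i ≡ 0ℤ
  to ki≡0 with ℤₚ.i*j≡0⇒i≡0∨j≡0 k ki≡0
  ... | inj₁ k≡0 = ⊥-elim (>0⇒≢0 k>0 k≡0)
  ... | inj₂ i≡0 = i≡0

≡0-cong⇔ : ∀ {i j} → i ≡ j → (i ≡ 0ℤ) ⇔ (j ≡ 0ℤ)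
≡0-cong⇔ i≡j = mk⇔ (trans (sym i≡j)) (trans i≡j)

≡⇔-≡0 : ∀ {i j} → (i ≡ j) ⇔ (i - j ≡ 0ℤ)
≡⇔-≡0 {i} {j} = mk⇔ ℤₚ.i≡j⇒i-j≡0 (ℤₚ.i-j≡0⇒i≡j i j)

Φ-vanish-scaled : ∀ {e a b c d} → 0ℤ < e →
                  Φ-vanish (e * a) (e * b) (e * c) (e * d) e ⇔ Φ-vanish a b c d 1ℤ
Φ-vanish-scaled {e} {a} {b} {c} {d} e>0 =
      (*≡0⇔≡0 e²>0 ⇔-∘ ≡0-cong⇔ (Φ₁-homogeneous e a b c d))
  ×-⇔ (*≡0⇔≡0 e³>0 ⇔-∘ ≡0-cong⇔ (Φ₂-homogeneous e a b c d))
  ×-⇔ (*≡0⇔≡0 e³>0 ⇔-∘ ≡0-cong⇔ (Φ₃-homogeneous e a b c d))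
  where
  e²>0 : 0ℤ < e * e
  e²>0 = >0-* e>0 e>0
  e³>0 : 0ℤ < e * e * e
  e³>0 = >0-* e²>0 e>0
  Φ₁-homogeneous : ∀ e a b c d → Φ₁ (e * a) (e * b) (e * c) (e * d) ≡ e * e * Φ₁ a b c d
  Φ₁-homogeneous = solve-∀
  Φ₂-homogeneous : ∀ e a b c d → Φ₂ (e * a) (e * b) (e * c) (e * d) e ≡ e * e * e * Φ₂ a b c d 1ℤ
  Φ₂-homogeneous = solve-∀
  Φ₃-homogeneous : ∀ e a b c d → Φ₃ (e * a) (e * b) (e * c) (e * d) e ≡ e * e * e * Φ₃ a b c d 1ℤ
  Φ₃-homogeneous = solve-∀

Φ₁-at-δ : ∀ a b c → Φ₁ a b c (δ a b c) ≡ Q a b c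
Φ₁-at-δ = solve-∀

onCone⇒Φ-vanish : ∀ {a b c} → OnCone a b c → Φ-vanish a b c (δ a b c) 1ℤ
onCone⇒Φ-vanish {a} {b} {c} cone =
  trans (Φ₁-at-δ a b c) (OnCone.Q≡0 cone) ,
  ≡-mod-cone cone (c - + 4 * b) (- (a * b)) (solve (a ∷ b ∷ c ∷ [])) ,
  ≡-mod-cone cone (c - + 4 * b) (- (a * b)) (solve (a ∷ b ∷ c ∷ []))

Φ-vanish⇒onCone : ∀ {a b c d} → 0ℤ < a → 0ℤ < b → 0ℤ < c → 0ℤ < d →
                  Φ-vanish a b c d 1ℤ → d ≡ δ a b c × OnCone a b c
Φ-vanish⇒onCone {a} {b} {c} {d} a>0 b>0 c>0 d>0 (Φ₁≡0 , Φ₂≡0 , Φ₃≡0) = d≡δ , record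
  { Q≡0 = Q≡0 ; ℓ≡1 = ℓ≡1 ; a>0 = a>0 ; b>0 = b>0 ; c>0 = c>0 ; δ>0 = subst (0ℤ <_) d≡δ d>0 }
  where
  Φ₂-Φ₃ : ∀ a b c d → Φ₂ a b c d 1ℤ - Φ₃ a b c d 1ℤ ≡ c * d * (δ a b c - d)
  Φ₂-Φ₃ = solve-∀
  Φ₂-at-δ : ∀ a b c → Φ₂ a b c (δ a b c) 1ℤ - (c - + 4 * b) * Q a b c ≡ a * b * (1ℤ - ℓ a b c)
  Φ₂-at-δ = solve-∀
  d≡δ : d ≡ δ a b c
  d≡δ = sym (ℤₚ.i-j≡0⇒i≡j _ d (Equivalence.to (*≡0⇔≡0 (>0-* c>0 d>0))
          (trans (sym (Φ₂-Φ₃ a b c d)) (cong₂ _-_ Φ₂≡0 Φ₃≡0))))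
  Q≡0 : Q a b c ≡ 0ℤ
  Q≡0 = trans (sym (Φ₁-at-δ a b c)) (subst (λ d → Φ₁ a b c d ≡ 0ℤ) d≡δ Φ₁≡0)
  ℓ≡1 : ℓ a b c ≡ 1ℤ
  ℓ≡1 = sym (ℤₚ.i-j≡0⇒i≡j 1ℤ _ (Equivalence.to (*≡0⇔≡0 (>0-* a>0 b>0)) (begin
    a * b * (1ℤ - ℓ a b c)                           ≡⟨ Φ₂-at-δ a b c ⟨
    Φ₂ a b c (δ a b c) 1ℤ - (c - + 4 * b) * Q a b c  ≡⟨ cong₂ (λ φ₂ q → φ₂ - (c - + 4 * b) * q)
                                                             (subst (λ d → Φ₂ a b c d 1ℤ ≡ 0ℤ) d≡δ Φ₂≡0) Q≡0 ⟩
    0ℤ - (c - + 4 * b) * 0ℤ                          ≡⟨ cong (_-_ 0ℤ) (ℤₚ.*-zeroʳ (c - + 4 * b)) ⟩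
    0ℤ                                               ∎)))
    where open ≡-Reasoning

fromℤ : ℤ → ℚ
fromℤ i = mkℚ i 0 (Coprime.sym (Coprime.1-coprimeTo ∣ i ∣))

fromℤ-+ : ∀ i j → fromℤ (i + j) ≡ fromℤ i ℚ.+ fromℤ j
fromℤ-+ i j = ℚₚ.toℚᵘ-injective (ℚᵘₚ.≃-trans (ℚᵘ.*≡* (cross-multiplied i j))
  (ℚᵘₚ.≃-sym (ℚₚ.toℚᵘ-homo-+ (fromℤ i) (fromℤ j))))
  where
  cross-multiplied : ∀ i j → (i + j) * (+ 1 * + 1) ≡ (i * + 1 + j * + 1) * + 1
  cross-multiplied = solve-∀

fromℤ-* : ∀ i j → fromℤ (i * j) ≡ fromℤ i ℚ.* fromℤ j
fromℤ-* i j = ℚₚ.toℚᵘ-injective (ℚᵘₚ.≃-trans (ℚᵘ.*≡* (cross-multiplied i j))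
  (ℚᵘₚ.≃-sym (ℚₚ.toℚᵘ-homo-* (fromℤ i) (fromℤ j))))
  where
  cross-multiplied : ∀ i j → i * j * (+ 1 * + 1) ≡ i * j * + 1
  cross-multiplied = solve-∀

fromℤ-injective : ∀ {i j} → fromℤ i ≡ fromℤ j → i ≡ j
fromℤ-injective = cong ℚ.numerator

-- Leaves for _⊕_ and _⊗_: they fix the integers, which Agda cannot recover from a
-- normalised rational.
ι : ∀ i → fromℤ i ≡ fromℤ i
ι i = refl

infixl 6 _⊕_
infixl 7 _⊗_

_⊕_ : ∀ {p q i j} → p ≡ fromℤ i → q ≡ fromℤ j → p ℚ.+ q ≡ fromℤ (i + j)
_⊕_ {i = i} {j} p≡ q≡ = trans (cong₂ ℚ._+_ p≡ q≡) (sym (fromℤ-+ i j))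

_⊗_ : ∀ {p q i j} → p ≡ fromℤ i → q ≡ fromℤ j → p ℚ.* q ≡ fromℤ (i * j)
_⊗_ {i = i} {j} p≡ q≡ = trans (cong₂ ℚ._*_ p≡ q≡) (sym (fromℤ-* i j))

÷⁺≡⇔≡* : ∀ (x y : ℚ⁺) r → (val (x ÷⁺ y) ≡ r) ⇔ (val x ≡ r ℚ.* val y)
÷⁺≡⇔≡* record { val = p } record { val = q ; pos = q>0 } r = mk⇔ to from
  where
  instance
    q≢0 : ℚ.NonZero q
    q≢0 = ℚₚ.pos⇒nonZero q {{q>0}}
  open ≡-Reasoning
  to : p ÷ q ≡ r → p ≡ r ℚ.* q
  to p/q≡r = begin
    p                     ≡⟨ ℚₚ.*-identityʳ p ⟨
    p ℚ.* ℚ.1ℚ            ≡⟨ cong (p ℚ.*_) (ℚₚ.*-inverseˡ q) ⟨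
    p ℚ.* (ℚ.1/ q ℚ.* q)  ≡⟨ ℚₚ.*-assoc p (ℚ.1/ q) q ⟨
    p ÷ q ℚ.* q           ≡⟨ cong (ℚ._* q) p/q≡r ⟩
    r ℚ.* q               ∎
  from : p ≡ r ℚ.* q → p ÷ q ≡ r
  from p≡rq = begin
    p ℚ.* ℚ.1/ q          ≡⟨ cong (ℚ._* ℚ.1/ q) p≡rq ⟩
    r ℚ.* q ℚ.* ℚ.1/ q    ≡⟨ ℚₚ.*-assoc r q (ℚ.1/ q) ⟩
    r ℚ.* (q ℚ.* ℚ.1/ q)  ≡⟨ cong (r ℚ.*_) (ℚₚ.*-inverseʳ q) ⟩
    r ℚ.* ℚ.1ℚ            ≡⟨ ℚₚ.*-identityʳ r ⟩
    r                     ∎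

÷⁺-fromℤ⇔ : ∀ (x y : ℚ⁺) {n d} k → val x ≡ fromℤ n → val y ≡ fromℤ d →
            (val (x ÷⁺ y) ≡ fromℤ k) ⇔ (n ≡ k * d)
÷⁺-fromℤ⇔ x y {n} {d} k x≡n y≡d = mk⇔ to from ⇔-∘ ÷⁺≡⇔≡* x y (fromℤ k)
  where
  to : val x ≡ fromℤ k ℚ.* val y → n ≡ k * d
  to x≡ky = fromℤ-injective (trans (sym x≡n) (trans x≡ky (ι k ⊗ y≡d)))
  from : n ≡ k * d → val x ≡ fromℤ k ℚ.* val y
  from n≡kd = trans x≡n (trans (cong fromℤ n≡kd) (sym (ι k ⊗ y≡d)))

embed : ℤ → ℤ → ℤ → ℤ → ℤ → ℚ × ℚ × ℚ × ℚ × ℚ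
embed A B C D E = fromℤ A , fromℤ B , fromℤ C , fromℤ D , fromℤ E

embed-≡ : ∀ {A B C D A′ B′ C′ D′ E} → A ≡ A′ → B ≡ B′ → C ≡ C′ → D ≡ D′ →
          embed A B C D E ≡ embed A′ B′ C′ D′ E
embed-≡ refl refl refl refl = refl

embed>0 : ∀ (x : Q5⁺) {A B C D E} → vals x ≡ embed A B C D E → 0ℤ < A × 0ℤ < B × 0ℤ < C × 0ℤ < D
embed>0 (record { pos = a>0 } , record { pos = b>0 } , record { pos = c>0 } , record { pos = d>0 } , _)
        {A} {B} {C} {D} refl =
  ℤₚ.positive⁻¹ A {{a>0}} , ℤₚ.positive⁻¹ B {{b>0}} , ℤₚ.positive⁻¹ C {{c>0}} , ℤₚ.positive⁻¹ D {{d>0}}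

β-embed : ∀ (x : Q5⁺) {A B C D E F} → vals x ≡ embed A B C D E →
          D * F ≡ A * C + B * E → vals (β x) ≡ embed B C F A E
β-embed (a@(⟨ _ ⟩) , b@(⟨ _ ⟩) , c@(⟨ _ ⟩) , d@(⟨ _ ⟩) , e@(⟨ _ ⟩)) {A} {B} {C} {D} {E} {F} refl DF≡ =
  cong (λ z → fromℤ B , fromℤ C , z , fromℤ A , fromℤ E)
       (Equivalence.from (÷⁺-fromℤ⇔ (a *⁺ c +⁺ b *⁺ e) d F (ι A ⊗ ι C ⊕ ι B ⊗ ι E) refl)
                         (trans (sym DF≡) (ℤₚ.*-comm D F)))

β⁻¹-embed : ∀ (x : Q5⁺) {A B C D E F} → vals x ≡ embed A B C D E →
            C * F ≡ B * D + A * E → vals (β⁻¹ x) ≡ embed D A B F E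
β⁻¹-embed (a@(⟨ _ ⟩) , b@(⟨ _ ⟩) , c@(⟨ _ ⟩) , d@(⟨ _ ⟩) , e@(⟨ _ ⟩)) {A} {B} {C} {D} {E} {F} refl CF≡ =
  cong (λ z → fromℤ D , fromℤ A , fromℤ B , z , fromℤ E)
       (Equivalence.from (÷⁺-fromℤ⇔ (d *⁺ b +⁺ a *⁺ e) c F (ι D ⊗ ι B ⊕ ι A ⊗ ι E) refl)
                         (trans (cong (_+ A * E) (ℤₚ.*-comm D B)) (trans (sym CF≡) (ℤₚ.*-comm C F))))

≡³⇔ : ∀ {x₁ x₂ x₃ y₁ y₂ y₃ : ℚ} → ((x₁ , x₂ , x₃) ≡ (y₁ , y₂ , y₃)) ⇔ (x₁ ≡ y₁ × x₂ ≡ y₂ × x₃ ≡ y₃)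
≡³⇔ = mk⇔ (λ { refl → refl , refl , refl }) (λ { (refl , refl , refl) → refl })

φ≡344⇔Φ-vanish : ∀ (x : Q5⁺) {A B C D E} → vals x ≡ embed A B C D E →
                 (φvals x ≡ (ℕ→ℚ 3 , ℕ→ℚ 4 , ℕ→ℚ 4)) ⇔ Φ-vanish A B C D E
φ≡344⇔Φ-vanish (a@(⟨ _ ⟩) , b@(⟨ _ ⟩) , c@(⟨ _ ⟩) , d@(⟨ _ ⟩) , e@(⟨ _ ⟩)) {A} {B} {C} {D} {E} refl =
  (    (≡⇔-≡0 ⇔-∘ ÷⁺-fromℤ⇔ (a *⁺ a +⁺ b *⁺ b +⁺ c *⁺ d) (a *⁺ b) (+ 3)
                   (ι A ⊗ ι A ⊕ ι B ⊗ ι B ⊕ ι C ⊗ ι D) (ι A ⊗ ι B))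
   ×-⇔ (≡⇔-≡0 ⇔-∘ ÷⁺-fromℤ⇔ (c *⁺ c *⁺ d +⁺ a *⁺ a *⁺ c +⁺ b *⁺ b *⁺ d +⁺ a *⁺ b *⁺ e) (b *⁺ c *⁺ d) (+ 4)
                   (ι C ⊗ ι C ⊗ ι D ⊕ ι A ⊗ ι A ⊗ ι C ⊕ ι B ⊗ ι B ⊗ ι D ⊕ ι A ⊗ ι B ⊗ ι E) (ι B ⊗ ι C ⊗ ι D))
   ×-⇔ (≡⇔-≡0 ⇔-∘ ÷⁺-fromℤ⇔ (c *⁺ d *⁺ d +⁺ a *⁺ a *⁺ c +⁺ b *⁺ b *⁺ d +⁺ a *⁺ b *⁺ e) (a *⁺ c *⁺ d) (+ 4)
                   (ι C ⊗ ι D ⊗ ι D ⊕ ι A ⊗ ι A ⊗ ι C ⊕ ι B ⊗ ι B ⊗ ι D ⊕ ι A ⊗ ι B ⊗ ι E) (ι A ⊗ ι C ⊗ ι D)))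
  ⇔-∘ ≡³⇔

-- β³ on scaled cone points

point : ℤ → Triple → ℚ × ℚ × ℚ × ℚ × ℚ
point e (a , b , c) = embed (e * a) (e * b) (e * c) (e * δ a b c) e

Tracks : ℤ → Q5⁺ → Triple → Set
Tracks e x s = InCone s × vals x ≡ point e s

exchange-scaled : ∀ e {a b c d f} → d * f ≡ a * c + b → e * d * (e * f) ≡ e * a * (e * c) + e * b * e
exchange-scaled e {a} {b} {c} {d} {f} df≡ = begin
  e * d * (e * f)              ≡⟨ solve (e ∷ d ∷ f ∷ []) ⟩
  e * e * (d * f)              ≡⟨ cong (e * e *_) df≡ ⟩
  e * e * (a * c + b)          ≡⟨ solve (e ∷ a ∷ b ∷ c ∷ []) ⟩
  e * a * (e * c) + e * b * e  ∎
  where open ≡-Reasoning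

β³-tracks : ∀ e {x s} → Tracks e x s → Tracks e (β (β (β x))) (μ s)
β³-tracks e {x} {s@(a , b , c)} (cone , x≡) =
  μ-inCone s cone , subst (λ z → vals (β (β (β x))) ≡ embed (e * p) (e * q) (e * r) (e * z) e) (sym (δ-σ q p c)) x₃≡
  where
  p q r : ℤ
  p = τ₂ a b c
  q = τ₁ a b c
  r = δ q p c
  x₁≡ : vals (β x) ≡ embed (e * b) (e * c) (e * p) (e * a) e
  x₁≡ = β-embed x x≡ (exchange-scaled e (exchange₁ cone))
  x₂≡ : vals (β (β x)) ≡ embed (e * c) (e * p) (e * q) (e * b) e
  x₂≡ = β-embed (β x) x₁≡ (exchange-scaled e (exchange₂ cone))
  x₃≡ : vals (β (β (β x))) ≡ embed (e * p) (e * q) (e * r) (e * c) e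
  x₃≡ = β-embed (β (β x)) x₂≡ (exchange-scaled e (exchange₃ cone))

-- The steps of β⁻¹ are the exchange relations of the swapped triple σ s = (b, a, δ), whose δ is c.
β⁻³-tracks : ∀ e {x s} → Tracks e x s → Tracks e (β⁻¹ (β⁻¹ (β⁻¹ x))) (μ⁻¹ s)
β⁻³-tracks e {x} {s@(a , b , c)} (cone , x≡) = μ⁻¹-inCone s cone , x₃≡
  where
  d p q : ℤ
  d = δ a b c
  p = τ₂ b a d
  q = τ₁ b a d
  σ-cone : OnCone b a d
  σ-cone = σ-onCone cone
  x₁≡ : vals (β⁻¹ x) ≡ embed (e * d) (e * a) (e * b) (e * p) e
  x₁≡ = β⁻¹-embed x x≡ (exchange-scaled e (subst (λ z → z * p ≡ b * d + a) (δ-σ a b c) (exchange₁ σ-cone)))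
  x₂≡ : vals (β⁻¹ (β⁻¹ x)) ≡ embed (e * p) (e * d) (e * a) (e * q) e
  x₂≡ = β⁻¹-embed (β⁻¹ x) x₁≡ (exchange-scaled e (exchange₂ σ-cone))
  x₃≡ : vals (β⁻¹ (β⁻¹ (β⁻¹ x))) ≡ embed (e * q) (e * p) (e * d) (e * δ q p d) e
  x₃≡ = β⁻¹-embed (β⁻¹ (β⁻¹ x)) x₂≡ (exchange-scaled e (exchange₃ σ-cone))

iterate-+ : ∀ {A : Set} (f : A → A) m n x → iterate f (m ℕ.+ n) x ≡ iterate f m (iterate f n x)
iterate-+ f zero    n x = refl
iterate-+ f (suc m) n x = cong f (iterate-+ f m n x)

iterate-simulation : ∀ {A B : Set} (R : A → B → Set) {f : A → A} {g : B → B} k →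
                     (∀ {x y} → R x y → R (iterate f k x) (g y)) →
                     ∀ n {x y} → R x y → R (iterate f (k ℕ.* n) x) (iterate g n y)
iterate-simulation R {f} k step zero {x} {y} r =
  subst (λ m → R (iterate f m x) y) (sym (ℕₚ.*-zeroʳ k)) r
iterate-simulation R {f} {g} k step (suc n) {x} {y} r =
  subst (λ z → R z (iterate g (suc n) y))
        (trans (sym (iterate-+ f k (k ℕ.* n) x)) (cong (λ m → iterate f m x) (sym (ℕₚ.*-suc k n))))
        (step (iterate-simulation R k step n r))

diag-tracks : ∀ ε .{{_ : NonZero ε}} → Tracks (+ ε) (diag ε) base
diag-tracks zero {{ε≢0}} = Irrelevant.⊥-elim (ℕ.NonZero.nonZero ε≢0)
diag-tracks ε@(suc _) = base-inCone , embed-≡ ε≡ε*1 ε≡ε*1 ε≡ε*1 ε≡ε*1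
  where
  base-inCone : InCone base
  base-inCone = record { Q≡0 = refl ; ℓ≡1 = refl ; a>0 = +<+ z<s ; b>0 = +<+ z<s ; c>0 = +<+ z<s ; δ>0 = +<+ z<s }
  ε≡ε*1 : + ε ≡ + ε * 1ℤ
  ε≡ε*1 = sym (ℤₚ.*-identityʳ (+ ε))

orbit-tracks : ∀ ε .{{_ : NonZero ε}} k → Tracks (+ ε) (β³^ k (diag ε)) (μ^ k base)
orbit-tracks ε (+ n)     =
  iterate-simulation (Tracks (+ ε)) {β} {μ} 3 (λ {x} {s} → β³-tracks (+ ε) {x} {s}) n (diag-tracks ε)
orbit-tracks ε -[1+ n ] =
  iterate-simulation (Tracks (+ ε)) {β⁻¹} {μ⁻¹} 3 (λ {x} {s} → β⁻³-tracks (+ ε) {x} {s}) (suc n) (diag-tracks ε)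

ConePoint : ℕ → Q5⁺ → Set
ConePoint ε P = ∃[ s ] Tracks (+ ε) P s

+-*-comm : ∀ m n → + (m ℕ.* n) ≡ + n * + m
+-*-comm m n = trans (cong +_ (ℕₚ.*-comm m n)) (ℤₚ.pos-* n m)

+>0 : ∀ n .{{_ : NonZero n}} → 0ℤ < + n
+>0 n = +<+ (ℕ.>-nonZero⁻¹ n)

Φ-vanish⇒tracks : ∀ {e a b c d} (x : Q5⁺) → 0ℤ < e → vals x ≡ embed (e * a) (e * b) (e * c) (e * d) e →
                  Φ-vanish a b c d 1ℤ → ∃[ s ] Tracks e x s
Φ-vanish⇒tracks {e} {a} {b} {c} {d} x e>0 x≡ Φ≡0 =
  (a , b , c) , proj₂ d≡δ×cone ,
  subst (λ z → vals x ≡ embed (e * a) (e * b) (e * c) (e * z) e) (proj₁ d≡δ×cone) x≡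
  where
  d≡δ×cone : d ≡ δ a b c × OnCone a b c
  d≡δ×cone =
    let ea>0 , eb>0 , ec>0 , ed>0 = embed>0 x x≡
    in Φ-vanish⇒onCone (>0-cofactor e>0 ea>0) (>0-cofactor e>0 eb>0) (>0-cofactor e>0 ec>0) (>0-cofactor e>0 ed>0) Φ≡0

InS⇒ConePoint : ∀ ε .{{_ : NonZero ε}} P → InS ε P → ConePoint ε P
InS⇒ConePoint ε P (_ , _ , _ , _ , P≡ , (divides-refl a , divides-refl b , divides-refl c , divides-refl d , _) , φ≡) =
  Φ-vanish⇒tracks P (+>0 ε) P≡εq
    (Equivalence.to (Φ-vanish-scaled {+ ε} {+ a} {+ b} {+ c} {+ d} (+>0 ε)) (Equivalence.to (φ≡344⇔Φ-vanish P P≡εq) φ≡))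
  where
  P≡εq : vals P ≡ embed (+ ε * + a) (+ ε * + b) (+ ε * + c) (+ ε * + d) (+ ε)
  P≡εq = trans P≡ (embed-≡ (+-*-comm a ε) (+-*-comm b ε) (+-*-comm c ε) (+-*-comm d ε))

ConePoint⇒InS : ∀ ε .{{_ : NonZero ε}} P → ConePoint ε P → InS ε P
ConePoint⇒InS ε P ((a , b , c) , cone , P≡) =
  ∣ a ∣ ℕ.* ε , ∣ b ∣ ℕ.* ε , ∣ c ∣ ℕ.* ε , ∣ δ a b c ∣ ℕ.* ε ,
  trans P≡ (embed-≡ (scaled a>0) (scaled b>0) (scaled c>0) (scaled δ>0)) ,
  (divides-refl ∣ a ∣ , divides-refl ∣ b ∣ , divides-refl ∣ c ∣ , divides-refl ∣ δ a b c ∣ , ∣-refl) ,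
  Equivalence.from (φ≡344⇔Φ-vanish P P≡) (Equivalence.from (Φ-vanish-scaled (+>0 ε)) (onCone⇒Φ-vanish cone))
  where
  open OnCone cone
  scaled : ∀ {i} → 0ℤ < i → + ε * i ≡ + (∣ i ∣ ℕ.* ε)
  scaled i>0 = trans (cong (+ ε *_) (sym (ℤₚ.0≤i⇒+∣i∣≡i (ℤₚ.<⇒≤ i>0)))) (sym (+-*-comm _ ε))

ConePoint⇔InOrbit : ∀ ε .{{_ : NonZero ε}} P → ConePoint ε P ⇔ InOrbit ε P
ConePoint⇔InOrbit ε P = mk⇔ to from
  where
  to : ConePoint ε P → InOrbit ε P
  to (s , cone , P≡) =
    let k , μ^k≡s = inCone⇒orbit s cone
    in k , trans (proj₂ (orbit-tracks ε k)) (trans (cong (point (+ ε)) μ^k≡s) (sym P≡))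
  from : InOrbit ε P → ConePoint ε P
  from (k , orbit≡P) = μ^ k base , proj₁ (orbit-tracks ε k) , trans (sym orbit≡P) (proj₂ (orbit-tracks ε k))

theorem4p4 : (ε : ℕ) → .{{_ : NonZero ε}} → (P : Q5⁺) → InS ε P ⇔ InOrbit ε P
theorem4p4 ε P = ConePoint⇔InOrbit ε P ⇔-∘ mk⇔ (InS⇒ConePoint ε P) (ConePoint⇒InS ε P)
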